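{- In first-order logic, every contradiction based on standard extension is a standard contradiction. Precisely: let $m\ge2$, let $D_1,\dots,D_m$ be first-order clauses with substitutions $\theta_1,\dots,\theta_m$, let $L_1,\dots,L_{m-1}$ be literals, and suppose sub-clauses $D_i^{\theta_i- }\subseteq D_i^{\theta_i}$ are given with $D_1^{\theta_1- }=\{L_1\}$, $D_i^{\theta_i- }=\{L_i,\neg L_{i-1}\}\cup E^i$ for $2\le i\le m-1$, and $D_m^{\theta_m- }=\{\neg L_{m-1}\}\cup E^m$, where $E^2=\emptyset$ and $E^j\subseteq\{\neg L_1,\dots,\neg L_{j-2}\}$ for $3\le j\le m$. Then for every tuple $(p_1,\dots,p_m)$ with $p_i\in D_i^{\theta_i- }$, there exist $i,j$ such that $p_i$ and $p_j$ are complementary.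
   Context: First-order logic. A literal is an atomic formula or its negation; two literals are complementary if one is $A$ and the other is $\neg A$ for the same (syntactically identical) atom $A$. A clause is a finite disjunction of literals, identified with the set of its literals, its variables implicitly universally quantified. For a substitution $\theta$, $D^{\theta}$ denotes the clause obtained by applying $\theta$ to every literal of $D$ and merging identical literals. A finite list of clauses $E_1,\dots,E_m$ is a standard contradiction if every tuple in $E_1\times\cdots\times E_m$ contains a complementary pair. The conjunction $\bigwedge_{i=1}^m D_i^{\theta_i- }$ as in the claim is called a contradiction based on standard extension of $D_1^{\theta_1},\dots,D_m^{\theta_m}$. -}

module Defs where

open import Data.Nat using (ℕ)
open import Data.List using (List; map; []; _∷_)
open import Data.List.Membership.Propositional using (_∈_)
open import Data.Product using (∃; _×_)
open import Data.Sum using (_⊎_)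
open import Relation.Binary.PropositionalEquality using (_≡_)

data Term : Set where
  var : ℕ → Term
  fun : ℕ → List Term → Term

data Atom : Set where
  atom : ℕ → List Term → Atom

data Literal : Set where
  pos : Atom → Literal
  neg : Atom → Literal

compl : Literal → Literal
compl (pos a) = neg a
compl (neg a) = pos a

Complementary : Literal → Literal → Set
Complementary l l′ = ∃ λ (a : Atom) → (l ≡ pos a × l′ ≡ neg a) ⊎ (l ≡ neg a × l′ ≡ pos a)

-- A clause is a finite set of literals, represented by a list (read up to membership).
Clause : Set
Clause = List Literal

Subst : Set
Subst = ℕ → Term

mutual
  substTerm : Subst → Term → Term
  substTerm σ (var x) = σ x
  substTerm σ (fun f ts) = fun f (substTerms σ ts)

  substTerms : Subst → List Term → List Term
  substTerms σ [] = []
  substTerms σ (t ∷ ts) = substTerm σ t ∷ substTerms σ ts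

substAtom : Subst → Atom → Atom
substAtom σ (atom P ts) = atom P (substTerms σ ts)

substLit : Subst → Literal → Literal
substLit σ (pos a) = pos (substAtom σ a)
substLit σ (neg a) = neg (substAtom σ a)

-- D^θ: apply θ to every literal (merging duplicates is immaterial for membership).
_^_ : Clause → Subst → Clause
D ^ θ = map (substLit θ) D

_⊆_ : Clause → Clause → Set
C ⊆ C′ = ∀ {l} → l ∈ C → l ∈ C′

-- The chosen literals start a chain p₁ = L₁, and every later pᵢ either continues it (pᵢ = Lᵢ, possible
-- only for i < m) or is the complement ¬Lₖ of some earlier chain literal, since E^i only contains such
-- complements. Following the chain from the left, the first index where it is not continued (at the
-- latest m) yields a literal complementary to an earlier one.
module Submission where

open import Defs
open import Data.Nat using (ℕ; _≤_; _<_; _∸_; suc; zero; z≤n; s≤s)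
open import Data.Nat.Properties using (≤-trans; ≤-refl; n≤1+n; m≤n⇒m≤1+n; <-irrefl; m≤n⇒m<n∨m≡n)
open import Data.List.Membership.Propositional using (_∈_; _∉_)
open import Data.Product using (∃; ∃₂; _×_; _,_)
open import Data.Sum using (_⊎_; inj₁; inj₂)
open import Data.Empty using (⊥-elim)
open import Relation.Binary.PropositionalEquality using (_≡_; refl)
open import Function.Bundles using (_⇔_; Equivalence)

≡compl⇒complementary : ∀ {l p q} → p ≡ l → q ≡ compl l → Complementary p q
≡compl⇒complementary {pos a} refl refl = a , inj₁ (refl , refl)
≡compl⇒complementary {neg a} refl refl = a , inj₂ (refl , refl)

Clash : (ℕ → Literal) → ℕ → Set
Clash P m = ∃₂ λ i j → (1 ≤ i × i ≤ m) × (1 ≤ j × j ≤ m) × Complementary (P i) (P j)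

ComplOfEarlier : (ℕ → Literal) → ℕ → Literal → Set
ComplOfEarlier L i p = ∃ λ k → 1 ≤ k × k < i × p ≡ compl (L k)

AgreesUpTo : (P L : ℕ → Literal) → ℕ → Set
AgreesUpTo P L n = ∀ k → 1 ≤ k → k ≤ n → P k ≡ L k

ChainStep : ℕ → (P L : ℕ → Literal) → ℕ → Set
ChainStep m P L i = (i < m × P i ≡ L i) ⊎ ComplOfEarlier L i (P i)

module _ {P L : ℕ → Literal} where

  agreesUpTo-suc : ∀ {n} → AgreesUpTo P L n → P (suc n) ≡ L (suc n) → AgreesUpTo P L (suc n)
  agreesUpTo-suc agree eq k 1≤k k≤1+n with m≤n⇒m<n∨m≡n k≤1+n
  ... | inj₁ (s≤s k≤n) = agree k 1≤k k≤n
  ... | inj₂ refl      = eq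

  clash-with-agreed : ∀ {m n} → AgreesUpTo P L n → suc n ≤ m →
                      ComplOfEarlier L (suc n) (P (suc n)) → Clash P m
  clash-with-agreed agree 1+n≤m (k , 1≤k , s≤s k≤n , eq) =
    k , _ , (1≤k , ≤-trans (m≤n⇒m≤1+n k≤n) 1+n≤m) , (s≤s z≤n , 1+n≤m) ,
    ≡compl⇒complementary (agree k 1≤k k≤n) eq

  clash-or-agreesUpTo : ∀ {m} → (∀ i → 1 ≤ i → i ≤ m → ChainStep m P L i) →
                        ∀ n → n ≤ m → Clash P m ⊎ AgreesUpTo P L n
  clash-or-agreesUpTo step zero    _     = inj₂ λ { (suc _) _ () }
  clash-or-agreesUpTo step (suc n) 1+n≤m with clash-or-agreesUpTo step n (≤-trans (n≤1+n n) 1+n≤m)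
  ... | inj₁ clash = inj₁ clash
  ... | inj₂ agree with step (suc n) (s≤s z≤n) 1+n≤m
  ...   | inj₁ (_ , eq) = inj₂ (agreesUpTo-suc agree eq)
  ...   | inj₂ earlier  = inj₁ (clash-with-agreed agree 1+n≤m earlier)

  chain-clash : ∀ {m} → 1 ≤ m → (∀ i → 1 ≤ i → i ≤ m → ChainStep m P L i) → Clash P m
  chain-clash {suc m} _ step with clash-or-agreesUpTo step m (n≤1+n m)
  ... | inj₁ clash = clash
  ... | inj₂ agree with step (suc m) (s≤s z≤n) ≤-refl
  ...   | inj₁ (m<m , _) = ⊥-elim (<-irrefl refl m<m)
  ...   | inj₂ earlier   = clash-with-agreed agree ≤-refl earlier

extension-complOfEarlier : ∀ {m} {L : ℕ → Literal} (E : ℕ → Clause) → (∀ p → p ∉ E 2) →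
  (∀ j → 3 ≤ j → j ≤ m → ∀ p → p ∈ E j → ∃ λ k → 1 ≤ k × k ≤ j ∸ 2 × p ≡ compl (L k)) →
  ∀ j → 2 ≤ j → j ≤ m → ∀ p → p ∈ E j → ComplOfEarlier L j p
extension-complOfEarlier E _ _ 1 (s≤s ()) _ _ _
extension-complOfEarlier E E2-empty _ 2 _ _ p p∈E = ⊥-elim (E2-empty p p∈E)
extension-complOfEarlier E _ E-compl (suc (suc (suc j))) (s≤s (s≤s z≤n)) j≤m p p∈E
  with E-compl (suc (suc (suc j))) (s≤s (s≤s (s≤s z≤n))) j≤m p p∈E
... | k , 1≤k , k≤1+j , eq = k , 1≤k , s≤s (m≤n⇒m≤1+n k≤1+j) , eq

theorem5p1 : (m : ℕ) → 2 ≤ m →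
    (D : ℕ → Clause) (θ : ℕ → Subst) (L : ℕ → Literal) (Dm : ℕ → Clause) (E : ℕ → Clause) →
    (∀ i → 1 ≤ i → i ≤ m → Dm i ⊆ (D i ^ θ i)) →
    (∀ p → (p ∈ Dm 1) ⇔ (p ≡ L 1)) →
    (∀ i → 2 ≤ i → i ≤ m ∸ 1 → ∀ p → (p ∈ Dm i) ⇔ (p ≡ L i ⊎ p ≡ compl (L (i ∸ 1)) ⊎ p ∈ E i)) →
    (∀ p → (p ∈ Dm m) ⇔ (p ≡ compl (L (m ∸ 1)) ⊎ p ∈ E m)) →
    (∀ p → p ∉ E 2) →
    (∀ j → 3 ≤ j → j ≤ m → ∀ p → p ∈ E j → ∃ λ k → 1 ≤ k × k ≤ j ∸ 2 × p ≡ compl (L k)) →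
    (P : ℕ → Literal) → (∀ i → 1 ≤ i → i ≤ m → P i ∈ Dm i) →
    ∃₂ λ i j → (1 ≤ i × i ≤ m) × (1 ≤ j × j ≤ m) × Complementary (P i) (P j)
theorem5p1 m@(suc (suc m′)) 2≤m@(s≤s (s≤s z≤n)) D θ L Dm E _ first middle last E2-empty E-compl P P∈Dm =
  chain-clash (s≤s z≤n) step
  where
  open Equivalence using (to)
  inE : ∀ j → 2 ≤ j → j ≤ m → ∀ p → p ∈ E j → ComplOfEarlier L j p
  inE = extension-complOfEarlier E E2-empty E-compl

  step : ∀ i → 1 ≤ i → i ≤ m → ChainStep m P L i
  step 1 1≤i i≤m = inj₁ (2≤m , to (first (P 1)) (P∈Dm 1 1≤i i≤m))
  step i@(suc (suc i′)) 1≤i i≤m with m≤n⇒m<n∨m≡n i≤m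
  ... | inj₁ i<m@(s≤s i≤m-1) with to (middle i (s≤s (s≤s z≤n)) i≤m-1 (P i)) (P∈Dm i 1≤i i≤m)
  ...   | inj₁ eq         = inj₁ (i<m , eq)
  ...   | inj₂ (inj₁ eq)  = inj₂ (suc i′ , s≤s z≤n , ≤-refl , eq)
  ...   | inj₂ (inj₂ p∈E) = inj₂ (inE i (s≤s (s≤s z≤n)) i≤m (P i) p∈E)
  step i@(suc (suc i′)) 1≤i i≤m | inj₂ refl with to (last (P m)) (P∈Dm m 1≤i i≤m)
  ...   | inj₁ eq  = inj₂ (suc m′ , s≤s z≤n , ≤-refl , eq)
  ...   | inj₂ p∈E = inj₂ (inE m 2≤m ≤-refl (P m) p∈E)
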